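{- Let $U$ be a countably infinite set and $\mathrm{G}$ a subgroup of $\mathfrak{S}(U)$. Then $\overline{\mathrm{G}}[U]\subseteq\widehat{\overline{\mathrm{G}}[U]}\subseteq\overline{\mathrm{G}}^{\mathfrak{rc}}[U]=\overline{\overline{\mathrm{G}}[U]}$.
   Context: $\overline{\mathrm{G}}$ is the closure of $\mathrm{G}$ in $U^U$ for the function topology (maps $f:U\to U$ such that every finite restriction of $f$ is a restriction of some $g\in\mathrm{G}$); $\overline{\mathrm{G}}[U]=\{f[U]\mid f\in\overline{\mathrm{G}}\}$ is the set of copies. $\widehat{\overline{\mathrm{G}}[U]}$ is the set of all intersections of (families of) members of $\overline{\mathrm{G}}[U]$. $\overline{\overline{\mathrm{G}}[U]}$ is the topological closure of $\overline{\mathrm{G}}[U]$ in $\mathcal{P}(U)$ for the powerset topology (basic open sets $\{A\subseteq U\mid F\subseteq A,\ E\cap A=\emptyset\}$, $F,E$ finite). $\overline{\mathrm{G}}^{\mathfrak{rc}}[U]=\{\mathfrak{rc}(S)\mid S\subseteq U\}$, where: for $F\subseteq U$, $\mathrm{G}\langle F\rangle=\{g\in\mathrm{G}\mid g(x)=x\ \forall x\in F\}$; a type is a pair $\langle F\mid p\rangle$ with $F$ finite, $p\in U$, with typeset $\mathrm{G}\langle F\mid p\rangle=\{g(p)\mid g\in\mathrm{G}\langle F\rangle\}$; $\mathfrak{R}_0$ is the set of types with finite typeset; $\langle F\mid p\rangle\in\mathfrak{R}_\alpha$ if there is a finite $F'\supseteq F$ such that for every $q\in\mathrm{G}\langle F\mid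 p\rangle$, $\langle F'\mid q\rangle\in\mathfrak{R}_\beta$ for some $\beta<\alpha$; a type is ranked if it lies in some $\mathfrak{R}_\alpha$; for finite $F$, $\mathfrak{rc}(F)$ is $F$ together with the union of the typesets of ranked types $\langle F\mid p\rangle$; for arbitrary $S$, $\mathfrak{rc}(S)=\bigcup\{\mathfrak{rc}(F)\mid F\text{ a finite subset of } S\}$. -}

module Defs where

open import Level using (0ℓ)
import Level
open import Data.Nat using (ℕ)
open import Data.List using (List)
open import Data.List.Membership.Propositional using (_∈_)
open import Data.Product using (Σ; ∃; _×_; _,_)
open import Data.Sum using (_⊎_)
open import Relation.Nullary using (¬_)
open import Relation.Binary.PropositionalEquality using (_≡_)
open import Function using (id; _∘_)
open import Function.Bundles using (_↔_)

CountablyInfinite : Set → Set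
CountablyInfinite U = U ↔ ℕ

Subset : Set → Set₁
Subset U = U → Set

_≐_ : {U : Set} → Subset U → Subset U → Set
A ≐ B = (∀ x → A x → B x) × (∀ x → B x → A x)

record IsPermGroup {U : Set} (G : (U → U) → Set) : Set where
  field
    has-id  : G id
    closed∘ : ∀ {f g} → G f → G g → G (f ∘ g)
    closed⁻¹ : ∀ {f} → G f → Σ (U → U) λ g → G g ×
                 ((∀ x → g (f x) ≡ x) × (∀ x → f (g x) ≡ x))

module _ {U : Set} (G : (U → U) → Set) where

  -- closure of G in U^U for the function topology
  Gbar : (U → U) → Set
  Gbar f = (F : List U) → Σ (U → U) λ g → G g × (∀ x → x ∈ F → f x ≡ g x)

  image : (U → U) → Subset U
  image f y = ∃ λ x → f x ≡ y

  Copies : Subset U → Set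
  Copies A = Σ (U → U) λ f → Gbar f × (A ≐ image f)

  Hat : Subset U → Set₁
  Hat A = Σ Set λ I → Σ (I → Subset U) λ B →
            (∀ i → Copies (B i)) × (A ≐ (λ x → ∀ i → B i x))

  -- topological closure (powerset topology) of a family of subsets
  Closure : ∀ {ℓ} → (Subset U → Set ℓ) → Subset U → Set (Level.suc 0ℓ Level.⊔ ℓ)
  Closure C A = (F E : List U) → (∀ x → x ∈ F → A x) → (∀ x → x ∈ E → ¬ A x) →
                Σ (Subset U) λ B → C B × (∀ x → x ∈ F → B x) × (∀ x → x ∈ E → ¬ B x)

  Fixes : List U → (U → U) → Set
  Fixes F g = ∀ x → x ∈ F → g x ≡ x

  Typeset : List U → U → Subset U
  Typeset F p q = Σ (U → U) λ g → G g × Fixes F g × (g p ≡ q)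

  FiniteSubset : Subset U → Set
  FiniteSubset A = Σ (List U) λ L → ∀ x → A x → x ∈ L

  -- Ranked types: the union over all ordinals α of 𝔑_α, rendered as
  -- the least fixed point of the defining clauses.
  data Ranked : List U → U → Set where
    rank0 : ∀ {F p} → FiniteSubset (Typeset F p) → Ranked F p
    rankS : ∀ {F p} (F' : List U) → (∀ x → x ∈ F → x ∈ F') →
            (∀ q → Typeset F p q → Ranked F' q) → Ranked F p

  rcFin : List U → Subset U
  rcFin F x = x ∈ F ⊎ Σ U λ p → Ranked F p × Typeset F p x

  rc : Subset U → Subset U
  rc S x = Σ (List U) λ F → (∀ y → y ∈ F → S y) × rcFin F x

  RcSets : Subset U → Set₁
  RcSets A = Σ (Subset U) λ S → A ≐ rc S

-- Every copy f[U], f ∈ Ḡ, is 𝔯𝔠-closed: if F ⊆ f[U] and ⟨F | p⟩ is ranked,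
-- then by induction on the rank the whole typeset G⟨F | p⟩ lies in f[U],
-- because the stabiliser G⟨F⟩ can move f so that its image covers any given
-- finite set.  Hence intersections of copies, and every set in the closure of
-- the copies, are 𝔯𝔠-closed, i.e. of the form 𝔯𝔠(S).  Conversely, if e ∉ 𝔯𝔠(F)
-- then ⟨F | e⟩ is unranked, and an unranked type over a finite set stays
-- unranked over a suitable G⟨F⟩-image of any further point.  Enumerating U,
-- this yields a coherent sequence of elements of G⟨F⟩ whose limit f ∈ Ḡ fixes
-- F and misses e; composing such maps gives copies in every basic
-- neighbourhood of a set 𝔯𝔠(S).

module Submission where

open import Defs
open import Level using (0ℓ; Lift; lift; lower)
import Level
open import Axiom.ExcludedMiddle using (ExcludedMiddle)
open import Data.Product using (Σ; ∃; _×_; _,_; proj₁; proj₂; map₂)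
open import Data.Sum using (inj₁; inj₂; [_,_]′)
open import Data.Unit using (⊤; tt)
open import Data.Empty using (⊥-elim)
open import Data.Nat using (ℕ; zero; suc; _≤′_; ≤′-refl; ≤′-step; s≤s)
open import Data.Nat.Properties using (≤⇒≤′)
open import Data.List using (List; []; _∷_; map; _++_)
open import Data.List.Properties using (map-∘)
open import Data.List.Extrema.Nat using (max; xs≤max)
open import Data.List.Membership.Propositional using (_∈_)
open import Data.List.Membership.Propositional.Properties
  using (∈-map⁺; ∈-map⁻; ∈-++⁺ˡ; ∈-++⁺ʳ; ∈-++⁻)
open import Data.List.Relation.Binary.Subset.Propositional using (_⊆_)
open import Data.List.Relation.Binary.Subset.Propositional.Properties
  using (⊆-trans; ⊆-reflexive; map⁺; ∷⁺ʳ; ++⁺ˡ; xs⊆xs++ys; xs⊆ys++xs)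
open import Data.List.Relation.Unary.All using (lookup)
open import Data.List.Relation.Unary.Any using (here; there)
open import Relation.Nullary using (¬_; Dec; yes; no)
open import Relation.Nullary.Decidable using (map′; decidable-stable)
open import Relation.Unary using (_⊆′_)
open import Relation.Binary.PropositionalEquality using (_≡_; refl; sym; trans; cong; subst)
open import Function using (id; _∘_)
open import Function.Bundles using (Inverse)

module PermutationGroup {U : Set} {G : (U → U) → Set} (isPermGroup : IsPermGroup G) where
  open IsPermGroup isPermGroup

  inv : ∀ {f} → G f → U → U
  inv Gf = proj₁ (closed⁻¹ Gf)

  inv∈G : ∀ {f} (Gf : G f) → G (inv Gf)
  inv∈G Gf = proj₁ (proj₂ (closed⁻¹ Gf))

  inverseˡ : ∀ {f} (Gf : G f) x → inv Gf (f x) ≡ x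
  inverseˡ Gf = proj₁ (proj₂ (proj₂ (closed⁻¹ Gf)))

  inverseʳ : ∀ {f} (Gf : G f) x → f (inv Gf x) ≡ x
  inverseʳ Gf = proj₂ (proj₂ (proj₂ (closed⁻¹ Gf)))

  G-injective : ∀ {f} → G f → ∀ {a b} → f a ≡ f b → a ≡ b
  G-injective Gf {a} {b} fa≡fb =
    trans (sym (inverseˡ Gf a)) (trans (cong (inv Gf) fa≡fb) (inverseˡ Gf b))

  image-cancel : ∀ {u f r} → G u → image G (u ∘ f) (u r) → image G f r
  image-cancel Gu = map₂ (G-injective Gu)

  Fixes-∘ : ∀ {F f g} → Fixes G F f → Fixes G F g → Fixes G F (f ∘ g)
  Fixes-∘ {f = f} fixes-f fixes-g x x∈F = trans (cong f (fixes-g x x∈F)) (fixes-f x x∈F)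

  Fixes-antitone : ∀ {F F' f} → F ⊆ F' → Fixes G F' f → Fixes G F f
  Fixes-antitone F⊆F' fixes x x∈F = fixes x (F⊆F' x∈F)

  Fixes-inv : ∀ {F f} (Gf : G f) → Fixes G F f → Fixes G F (inv Gf)
  Fixes-inv Gf fixes x x∈F = trans (cong (inv Gf) (sym (fixes x x∈F))) (inverseˡ Gf x)

  map-fixed : ∀ {F f} → Fixes G F f → map f F ⊆ F
  map-fixed {F} fixes y∈fF with ∈-map⁻ _ y∈fF
  ... | x , x∈F , refl = subst (_∈ F) (sym (fixes x x∈F)) x∈F

  Typeset-refl : ∀ F p → Typeset G F p p
  Typeset-refl F p = id , has-id , (λ _ _ → refl) , refl

  Typeset-act : ∀ {F p q h} → G h → Fixes G F h → Typeset G F p q → Typeset G F p (h q)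
  Typeset-act {h = h} Gh fixes-h (a , Ga , fixes-a , refl) =
    h ∘ a , closed∘ Gh Ga , Fixes-∘ fixes-h fixes-a , refl

  Typeset-antitone : ∀ {F F' p q} → F ⊆ F' → Typeset G F' p q → Typeset G F p q
  Typeset-antitone F⊆F' (a , Ga , fixes , ap≡q) = a , Ga , Fixes-antitone F⊆F' fixes , ap≡q

  Typeset-conjugate : ∀ {F p c q} (Gc : G c) →
                      Typeset G (map c F) (c p) q → Typeset G F p (inv Gc q)
  Typeset-conjugate {c = c} Gc (h , Gh , fixes , refl) =
    inv Gc ∘ h ∘ c , closed∘ (inv∈G Gc) (closed∘ Gh Gc) ,
    (λ x x∈F → trans (cong (inv Gc) (fixes (c x) (∈-map⁺ c x∈F))) (inverseˡ Gc x)) , refl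

  Ranked-mono : ∀ {F F' p} → F ⊆ F' → Ranked G F p → Ranked G F' p
  Ranked-mono F⊆F' (rank0 (L , finite)) =
    rank0 (L , λ q t → finite q (Typeset-antitone F⊆F' t))
  Ranked-mono {F' = F'} F⊆F' (rankS F'' _ ranked) =
    rankS (F'' ++ F') (λ _ → xs⊆ys++xs F' F'')
      (λ q t → Ranked-mono (xs⊆xs++ys F'' F') (ranked q (Typeset-antitone F⊆F' t)))

  Ranked-map : ∀ {F p c} (Gc : G c) → Ranked G F p → Ranked G (map c F) (c p)
  Ranked-map {c = c} Gc (rank0 (L , finite)) =
    rank0 (map c L , λ q t →
      subst (_∈ map c L) (inverseʳ Gc q) (∈-map⁺ c (finite _ (Typeset-conjugate Gc t))))
  Ranked-map {c = c} Gc (rankS F' F⊆F' ranked) =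
    rankS (map c F') (λ _ → map⁺ c (F⊆F' _)) (λ q t →
      subst (Ranked G (map c F')) (inverseʳ Gc q) (Ranked-map Gc (ranked _ (Typeset-conjugate Gc t))))

  Ranked-∈ : ∀ {F p} → p ∈ F → Ranked G F p
  Ranked-∈ {p = p} p∈F =
    rank0 (p ∷ [] , λ { _ (h , _ , fixes , refl) → here (fixes p p∈F) })

  Ranked-typeset : ∀ {F p q} → Ranked G F p → Typeset G F p q → Ranked G F q
  Ranked-typeset ranked (a , Ga , fixes , refl) = Ranked-mono (map-fixed fixes) (Ranked-map Ga ranked)

  rcFin-mono : ∀ {F F'} → F ⊆ F' → rcFin G F ⊆′ rcFin G F'
  rcFin-mono F⊆F' _ (inj₁ x∈F) = inj₁ (F⊆F' x∈F)
  rcFin-mono {F' = F'} F⊆F' x (inj₂ (_ , ranked , t)) =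
    inj₂ (x , Ranked-mono F⊆F' (Ranked-typeset ranked t) , Typeset-refl F' x)

  rc-finitary : ∀ {S} L → (_∈ L) ⊆′ rc G S →
                ∃ λ F → (_∈ F) ⊆′ S × (_∈ L) ⊆′ rcFin G F
  rc-finitary [] _ = [] , (λ _ ()) , (λ _ ())
  rc-finitary {S} (x ∷ L) L⊆rc with L⊆rc x (here refl) | rc-finitary L (λ y → L⊆rc y ∘ there)
  ... | Fx , Fx⊆S , x∈rcFx | F , F⊆S , L⊆rcF = Fx ++ F , Fx++F⊆S , x∷L⊆rc
    where
      Fx++F⊆S : (_∈ Fx ++ F) ⊆′ S
      Fx++F⊆S y y∈ = [ Fx⊆S y , F⊆S y ]′ (∈-++⁻ Fx y∈)
      x∷L⊆rc : (_∈ x ∷ L) ⊆′ rcFin G (Fx ++ F)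
      x∷L⊆rc _ (here refl) = rcFin-mono (xs⊆xs++ys Fx F) x x∈rcFx
      x∷L⊆rc y (there y∈L) = rcFin-mono (xs⊆ys++xs F Fx) y (L⊆rcF y y∈L)

  G⊆Gbar : ∀ {g} → G g → Gbar G g
  G⊆Gbar {g} Gg _ = g , Gg , λ _ _ → refl

  Gbar-∘ : ∀ {f g} → Gbar G f → Gbar G g → Gbar G (f ∘ g)
  Gbar-∘ {g = g} Gbar-f Gbar-g L with Gbar-g L
  ... | g' , Gg' , g≈g' with Gbar-f (map g L)
  ... | f' , Gf' , f≈f' =
    f' ∘ g' , closed∘ Gf' Gg' , λ x x∈L → trans (f≈f' (g x) (∈-map⁺ g x∈L)) (cong f' (g≈g' x x∈L))

  Gbar-injective : ∀ {f} → Gbar G f → ∀ {a b} → f a ≡ f b → a ≡ b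
  Gbar-injective Gbar-f {a} {b} fa≡fb with Gbar-f (a ∷ b ∷ [])
  ... | g , Gg , f≈g =
    G-injective Gg (trans (sym (f≈g a (here refl))) (trans fa≡fb (f≈g b (there (here refl)))))

  Gbar-typeset : ∀ {F f p} → Gbar G f → Fixes G F f → Typeset G F p (f p)
  Gbar-typeset {F} {p = p} Gbar-f fixes with Gbar-f (p ∷ F)
  ... | g , Gg , f≈g =
    g , Gg , (λ x x∈F → trans (sym (f≈g x (there x∈F))) (fixes x x∈F)) , sym (f≈g p (here refl))

  Ranked-Gbar-image : ∀ {F f z} → Gbar G f → Fixes G F f → Ranked G F z → rcFin G F (f z)
  Ranked-Gbar-image Gbar-f fixes ranked = inj₂ (_ , ranked , Gbar-typeset Gbar-f fixes)

  finite-preimage : ∀ {f} F → (_∈ F) ⊆′ image G f → ∃ λ F₀ → F ⊆ map f F₀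
  finite-preimage [] _ = [] , λ ()
  finite-preimage (y ∷ F) F⊆f with F⊆f y (here refl) | finite-preimage F (λ x → F⊆f x ∘ there)
  ... | z , refl | F₀ , F⊆fF₀ = z ∷ F₀ , λ { (here refl) → here refl ; (there y∈F) → there (F⊆fF₀ y∈F) }

  -- With g ≈ f on the preimage F₀ of F and h ≈ f also on g⁻¹X, the map
  -- g ∘ h⁻¹ undoes h on f[F₀] ⊇ F and sends f(g⁻¹ y) to y.
  stabiliser-covers : ∀ {f F} → Gbar G f → (_∈ F) ⊆′ image G f → ∀ X →
                      ∃ λ u → G u × Fixes G F u × (_∈ X) ⊆′ image G (u ∘ f)
  stabiliser-covers {f} Gbar-f F⊆f X with finite-preimage _ F⊆f
  ... | F₀ , F⊆fF₀ with Gbar-f F₀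
  ... | g , Gg , f≈g with Gbar-f (F₀ ++ map (inv Gg) X)
  ... | h , Gh , f≈h = g ∘ inv Gh , closed∘ Gg (inv∈G Gh) , fixes , covers
    where
      h⁻¹f≈id : ∀ z → z ∈ F₀ ++ map (inv Gg) X → inv Gh (f z) ≡ z
      h⁻¹f≈id z z∈ = trans (cong (inv Gh) (f≈h z z∈)) (inverseˡ Gh z)
      fixes : Fixes G _ (g ∘ inv Gh)
      fixes y y∈F with ∈-map⁻ f (F⊆fF₀ y∈F)
      ... | z , z∈F₀ , refl = trans (cong g (h⁻¹f≈id z (∈-++⁺ˡ z∈F₀))) (sym (f≈g z z∈F₀))
      covers : (_∈ X) ⊆′ image G (g ∘ inv Gh ∘ f)
      covers y y∈X =
        inv Gg y , trans (cong g (h⁻¹f≈id _ (∈-++⁺ʳ F₀ (∈-map⁺ (inv Gg) y∈X)))) (inverseʳ Gg y)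

  -- Move f by u ∈ G⟨F⟩ so that its image covers the finite typeset (rank 0),
  -- resp. the larger parameter set F' (which makes the induction hypothesis
  -- applicable to u ∘ f); then cancel u.
  Typeset⊆image : ∀ {F p f} → Ranked G F p → Gbar G f → (_∈ F) ⊆′ image G f →
                  Typeset G F p ⊆′ image G f
  Typeset⊆image (rank0 (L , finite)) Gbar-f F⊆f r t with stabiliser-covers Gbar-f F⊆f L
  ... | u , Gu , fixes-u , L⊆uf =
    image-cancel Gu (L⊆uf (u r) (finite (u r) (Typeset-act Gu fixes-u t)))
  Typeset⊆image (rankS F' _ ranked) Gbar-f F⊆f r t with stabiliser-covers Gbar-f F⊆f F'
  ... | u , Gu , fixes-u , F'⊆uf =
    image-cancel Gu (Typeset⊆image (ranked (u r) (Typeset-act Gu fixes-u t))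
                                   (Gbar-∘ (G⊆Gbar Gu) Gbar-f) F'⊆uf (u r) (Typeset-refl F' (u r)))

  RcClosed : Subset U → Set
  RcClosed A = ∀ F → (_∈ F) ⊆′ A → rcFin G F ⊆′ A

  RcClosed-resp-≐ : ∀ {A B} → A ≐ B → RcClosed B → RcClosed A
  RcClosed-resp-≐ (A⊆B , B⊆A) closed F F⊆A x x∈rc =
    B⊆A x (closed F (λ y → A⊆B y ∘ F⊆A y) x x∈rc)

  RcClosed⇒RcSets : ∀ {A} → RcClosed A → RcSets G A
  RcClosed⇒RcSets {A} closed =
    A , (λ x x∈A → x ∷ [] , (λ { _ (here refl) → x∈A }) , inj₁ (here refl)) ,
        (λ { x (F , F⊆A , x∈rc) → closed F F⊆A x x∈rc })

  image-rcClosed : ∀ {f} → Gbar G f → RcClosed (image G f)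
  image-rcClosed Gbar-f F F⊆f x (inj₁ x∈F) = F⊆f x x∈F
  image-rcClosed Gbar-f F F⊆f x (inj₂ (_ , ranked , t)) = Typeset⊆image ranked Gbar-f F⊆f x t

  Copies⇒RcClosed : ∀ {A} → Copies G A → RcClosed A
  Copies⇒RcClosed (_ , Gbar-f , A≐f[U]) = RcClosed-resp-≐ A≐f[U] (image-rcClosed Gbar-f)

  Copies⇒Hat : ∀ {A} → Copies G A → Hat G A
  Copies⇒Hat {A} copy = ⊤ , (λ _ → A) , (λ _ → copy) , (λ _ x∈A _ → x∈A) , (λ _ x∈A → x∈A tt)

  Hat⇒RcClosed : ∀ {A} → Hat G A → RcClosed A
  Hat⇒RcClosed (_ , B , copies , A⊆⋂B , ⋂B⊆A) F F⊆A x x∈rc =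
    ⋂B⊆A x λ i → Copies⇒RcClosed (copies i) F (λ y y∈F → A⊆⋂B y (F⊆A y y∈F) i) x x∈rc

  module Enumerated (countable : CountablyInfinite U) where
    open Inverse countable using (to; from; strictlyInverseʳ)

    enumeration : ℕ → List U
    enumeration zero = []
    enumeration (suc n) = from n ∷ enumeration n

    ∈-enumeration : ∀ x → x ∈ enumeration (suc (to x))
    ∈-enumeration x = here (sym (strictlyInverseʳ x))

    enumeration-mono : ∀ {m n} → m ≤′ n → enumeration m ⊆ enumeration n
    enumeration-mono ≤′-refl = id
    enumeration-mono (≤′-step m≤n) = there ∘ enumeration-mono m≤n

    Gbar-limit : (g : ℕ → U → U) → (∀ n → G (g n)) →
                 (∀ n x → x ∈ enumeration n → g (suc n) x ≡ g n x) →
                 Gbar G (λ x → g (suc (to x)) x)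
    Gbar-limit g Gg coherent L = g N , Gg N , settled-by-N
      where
        N : ℕ
        N = suc (max 0 (map to L))
        settled : ∀ {m n} x → x ∈ enumeration m → m ≤′ n → g n x ≡ g m x
        settled x x∈ ≤′-refl = refl
        settled x x∈ (≤′-step m≤n) = trans (coherent _ x (enumeration-mono m≤n x∈)) (settled x x∈ m≤n)
        settled-by-N : ∀ x → x ∈ L → g (suc (to x)) x ≡ g N x
        settled-by-N x x∈L =
          sym (settled x (∈-enumeration x) (≤⇒≤′ (s≤s (lookup (xs≤max 0 (map to L)) (∈-map⁺ to x∈L)))))

  module Classical (em : ExcludedMiddle (Level.suc 0ℓ)) (countable : CountablyInfinite U) where
    open Enumerated countable
    open Inverse countable using (to; from)

    decide : (P : Set) → Dec P
    decide P = map′ lower lift (em {Lift _ P})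

    -- Otherwise every point of the typeset would be ranked over y ∷ K, which
    -- is exactly the clause rankS making ⟨K | e⟩ ranked.
    ¬Ranked-extend : ∀ {K e} → ¬ Ranked G K e → ∀ y →
                     ∃ λ a → G a × Fixes G K a × ¬ Ranked G (a y ∷ K) e
    ¬Ranked-extend {K} {e} unranked y with decide (∃ λ q → Typeset G K e q × ¬ Ranked G (y ∷ K) q)
    ... | no none = ⊥-elim (unranked (rankS (y ∷ K) (λ _ → there) λ q t →
            decidable-stable (decide _) (λ unranked-q → none (q , t , unranked-q))))
    ... | yes (_ , (b , Gb , fixes-b , refl) , unranked-be) =
      inv Gb , inv∈G Gb , Fixes-inv Gb fixes-b , λ ranked →
        unranked-be (Ranked-mono (∷⁺ʳ y (map-fixed fixes-b))
          (subst (λ w → Ranked G (w ∷ map b K) (b e)) (inverseʳ Gb y) (Ranked-map Gb ranked)))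

    module Avoiding {H : List U} {e : U} (unranked : ¬ Ranked G H e) where

      record Approximation (n : ℕ) : Set where
        constructor approximation
        field
          perm : U → U
          perm∈G : G perm
          perm-fixes : Fixes G H perm
          perm-unranked : ¬ Ranked G (map perm (enumeration n) ++ H) e
      open Approximation

      refine : ∀ {n} (a : Approximation n) →
               Σ (Approximation (suc n)) λ a' → ∀ x → x ∈ enumeration n → perm a' x ≡ perm a x
      refine {n} (approximation g Gg fixes-g unranked-g)
        with ¬Ranked-extend unranked-g (g (from n))
      ... | a , Ga , fixes-a , unranked-a =
        approximation (a ∘ g) (closed∘ Ga Gg)
          (Fixes-∘ (Fixes-antitone (xs⊆ys++xs H _) fixes-a) fixes-g)
          (unranked-a ∘ Ranked-mono (∷⁺ʳ _ (++⁺ˡ H agℰ⊆gℰ))) ,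
        λ x x∈ℰ → fixes-a (g x) (∈-++⁺ˡ (∈-map⁺ g x∈ℰ))
        where
          agℰ⊆gℰ : map (a ∘ g) (enumeration n) ⊆ map g (enumeration n)
          agℰ⊆gℰ = ⊆-trans (⊆-reflexive (map-∘ (enumeration n)))
                           (map-fixed (Fixes-antitone (xs⊆xs++ys _ H) fixes-a))

      approximations : ∀ n → Approximation n
      approximations zero = approximation id has-id (λ _ _ → refl) unranked
      approximations (suc n) = proj₁ (refine (approximations n))

      limit : U → U
      limit x = perm (approximations (suc (to x))) x

      limit∈Gbar : Gbar G limit
      limit∈Gbar = Gbar-limit (perm ∘ approximations) (perm∈G ∘ approximations)
                      (λ n → proj₂ (refine (approximations n)))

      limit-fixes : Fixes G H limit
      limit-fixes x = perm-fixes (approximations (suc (to x))) x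

      limit-misses : ¬ image G limit e
      limit-misses (x , limit-x≡e) = perm-unranked aₓ
        (Ranked-∈ (∈-++⁺ˡ (subst (_∈ map (perm aₓ) (enumeration (suc (to x)))) limit-x≡e
                                 (∈-map⁺ (perm aₓ) (∈-enumeration x)))))
        where
          aₓ : Approximation (suc (to x))
          aₓ = approximations (suc (to x))

    avoid-unranked : ∀ {H e} → ¬ Ranked G H e → ∃ λ f → Gbar G f × Fixes G H f × ¬ image G f e
    avoid-unranked unranked = limit , limit∈Gbar , limit-fixes , limit-misses
      where open Avoiding unranked

    -- If e = f z then z is unranked over F, since otherwise f z would lie in
    -- the typeset of the ranked type ⟨F | z⟩; compose f with a map missing z.
    avoid-outside-rc : ∀ F E → (∀ e → e ∈ E → ¬ rcFin G F e) →
                       ∃ λ f → Gbar G f × Fixes G F f × (∀ e → e ∈ E → ¬ image G f e)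
    avoid-outside-rc F [] _ = id , G⊆Gbar has-id , (λ _ _ → refl) , (λ _ ())
    avoid-outside-rc F (e ∷ E) outside with avoid-outside-rc F E (λ e' → outside e' ∘ there)
    ... | f , Gbar-f , fixes-f , misses-E with decide (image G f e)
    ... | no e∉f = f , Gbar-f , fixes-f , λ { _ (here refl) → e∉f ; e' (there e'∈E) → misses-E e' e'∈E }
    ... | yes (z , refl)
      with avoid-unranked {e = z} (outside _ (here refl) ∘ Ranked-Gbar-image Gbar-f fixes-f)
    ... | h , Gbar-h , fixes-h , z∉h = f ∘ h , Gbar-∘ Gbar-f Gbar-h , Fixes-∘ fixes-f fixes-h , misses
      where
        misses : ∀ e' → e' ∈ e ∷ E → ¬ image G (f ∘ h) e'
        misses _ (here refl) (x , fhx≡fz) = z∉h (x , Gbar-injective Gbar-f fhx≡fz)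
        misses e' (there e'∈E) (x , fhx≡e') = misses-E e' e'∈E (h x , fhx≡e')

    Closure⇒RcClosed : ∀ {A} → Closure G (Copies G) A → RcClosed A
    Closure⇒RcClosed {A} closure F F⊆A x x∈rc = decidable-stable (decide (A x)) λ x∉A →
      let (_ , copy , F⊆B , x∉B) = closure F (x ∷ []) F⊆A (λ { _ (here refl) → x∉A })
      in x∉B x (here refl) (Copies⇒RcClosed copy F F⊆B x x∈rc)

    RcSets⇒Closure : ∀ {A} → RcSets G A → Closure G (Copies G) A
    RcSets⇒Closure (S , A⊆rcS , rcS⊆A) F E F⊆A E∩A≡∅
      with rc-finitary F (λ x → A⊆rcS x ∘ F⊆A x)
    ... | F₁ , F₁⊆S , F⊆rcF₁ with avoid-outside-rc F₁ E (λ e e∈E r → E∩A≡∅ e e∈E (rcS⊆A e (F₁ , F₁⊆S , r)))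
    ... | f , Gbar-f , fixes-f , misses =
      image G f , (f , Gbar-f , (λ _ → id) , (λ _ → id)) ,
      (λ x x∈F → image-rcClosed Gbar-f F₁ (λ y y∈F₁ → y , fixes-f y y∈F₁) x (F⊆rcF₁ x x∈F)) ,
      misses

lemma2p11 : ExcludedMiddle (Level.suc 0ℓ) →
    {U : Set} → CountablyInfinite U →
    (G : (U → U) → Set) → IsPermGroup G →
    ((A : Subset U) → Copies G A → Hat G A) ×
    ((A : Subset U) → Hat G A → RcSets G A) ×
    ((A : Subset U) → RcSets G A → Closure G (Copies G) A) ×
    ((A : Subset U) → Closure G (Copies G) A → RcSets G A)
lemma2p11 em countable G isPermGroup =
    (λ _ → Copies⇒Hat)
  , (λ _ → RcClosed⇒RcSets ∘ Hat⇒RcClosed)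
  , (λ _ → RcSets⇒Closure)
  , (λ _ → RcClosed⇒RcSets ∘ Closure⇒RcClosed)
  where
    open PermutationGroup isPermGroup
    open Classical em countable
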